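{- Let $\rho_{\mathcal{E}}=((n_1,r_1),\dots,(n_k,r_k))$ be an expanded route and let $\rho=\mathcal{E}^{ -1}(\rho_{\mathcal{E}})=(n_1,\dots,n_k)$. Then $L(\rho_{\mathcal{E}})=L(\rho)$ and $C(\rho_{\mathcal{E}})\ge C(\rho)$.
   Context: Let $V$ be a finite set of nodes. A road is a finite sequence of distinct nodes of $V$. Let $R$ be a finite set of roads such that every node lies on at least one road and any pair of consecutive nodes of some road does not appear (as consecutive nodes) in any other road. For $n\in V$, $R(n)$ is the set of roads containing $n$. The road network $G_R=(V,E)$ is the directed graph with an edge $(n_i,n_j)$ whenever $n_i,n_j$ are consecutive nodes of some road; $R(n_i,n_j)$ denotes the unique road containing this segment. A length function $L:E\to\mathbb{R}^+$ is given. The turn cost is $C(n,r,r')=1$ if $r\neq r'$ and $C(n,r,r)=0$ ($r,r'\in R(n)$). A route is a sequence of nodes $\rho=(n_1,\dots,n_k)$ with $(n_m,n_{m+1})\in E$ for all $m$; its length is $L(\rho)=\sum_{m=1}^{k-1}L(n_m,n_{m+1})$ and its complexity is $C(\rho)=\sum_{m=2}^{k-1}C(n_m,R(n_{m-1},n_m),R(n_m,n_{m+1}))$. The expanded graph $G_{\mathcal{E}}$ has expanded nodes $(n,r)$ with $r\in R(n)$ and an edge $((n_x,r_i),(n_y,r_j))$ whenever $r_i,r_j\in R(n_x)$ ($r_i=r_j$ allowed) and $n_x,n_y$ are consecutive nodes of $r_j$. An expanded route $\rho_{\mathcal{E}}=((n_1,r_1),\dots,(n_k,r_k))$ is a path in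 $G_{\mathcal{E}}$, with length $L(\rho_{\mathcal{E}})=\sum_{m=1}^{k-1}L(n_m,n_{m+1})$ and complexity $C(\rho_{\mathcal{E}})=\sum_{m=1}^{k-1}C(n_m,r_m,r_{m+1})$. The associated route $\mathcal{E}^{ -1}(\rho_{\mathcal{E}})$ is the node sequence $(n_1,\dots,n_k)$ obtained by dropping the roads. -}

module Defs where

open import Data.Nat using (ℕ; zero; suc; _+_)
open import Data.Fin using (Fin; _≟_)
open import Data.List using (List; []; _∷_; [_]; map)
open import Data.List.Relation.Unary.Unique.Propositional using (Unique)
open import Data.List.Membership.Propositional using (_∈_)
open import Data.Product using (Σ; ∃; _×_; _,_; proj₁)
open import Relation.Nullary using (yes; no)
open import Relation.Binary.PropositionalEquality using (_≡_)

data Consec {A : Set} (a b : A) : List A → Set where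
  here  : ∀ {xs} → Consec a b (a ∷ b ∷ xs)
  there : ∀ {x xs} → Consec a b xs → Consec a b (x ∷ xs)

record RoadNetwork : Set where
  field
    nV nR     : ℕ
    road      : Fin nR → List (Fin nV)
    -- R is a set of roads (no road listed twice)
    road-inj  : ∀ r r' → road r ≡ road r' → r ≡ r'
    distinct  : ∀ r → Unique (road r)
    covers    : ∀ (n : Fin nV) → ∃ λ r → n ∈ road r
    segUnique : ∀ (a b : Fin nV) r r' →
                Consec a b (road r) → Consec a b (road r') → r ≡ r'

module _ (N : RoadNetwork) where
  open RoadNetwork N

  -- (a , b) ∈ E : a and b are consecutive nodes of some road,
  -- the witness road is R(a , b) (unique by segUnique).
  Edge : Fin nV → Fin nV → Set
  Edge a b = Σ (Fin nR) λ r → Consec a b (road r)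

  turn : Fin nR → Fin nR → ℕ
  turn r r' with r ≟ r'
  ... | yes _ = 0
  ... | no  _ = 1

  data Route : List (Fin nV) → Set where
    single : ∀ n → Route [ n ]
    step   : ∀ {a b ns} → Edge a b → Route (b ∷ ns) → Route (a ∷ b ∷ ns)

  -- complexity C(ρ) = Σ_{m=2}^{k-1} C(n_m , R(n_{m-1},n_m) , R(n_m,n_{m+1}))
  routeC : ∀ {ns} → Route ns → ℕ
  routeC (single n) = 0
  routeC (step e (single b)) = 0
  routeC (step e (step e' p)) = turn (proj₁ e) (proj₁ e') + routeC (step e' p)

  -- expanded routes: paths in G_E, expanded nodes (n , r) with r ∈ R(n);
  -- edge ((n_x,r_i),(n_y,r_j)) iff r_i, r_j ∈ R(n_x) and n_x, n_y are
  -- consecutive nodes of r_j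
  data ERoute : List (Fin nV × Fin nR) → Set where
    single : ∀ n r → n ∈ road r → ERoute [ (n , r) ]
    step   : ∀ {nx ri ny rj rest} →
             nx ∈ road ri → nx ∈ road rj → Consec nx ny (road rj) →
             ERoute ((ny , rj) ∷ rest) →
             ERoute ((nx , ri) ∷ (ny , rj) ∷ rest)

  -- complexity C(ρ_E) = Σ_{m=1}^{k-1} C(n_m , r_m , r_{m+1})
  eRouteC : ∀ {es} → ERoute es → ℕ
  eRouteC (single n r _) = 0
  eRouteC (step {ri = ri} {rj = rj} _ _ _ p) = turn ri rj + eRouteC p

  unexpand : List (Fin nV × Fin nR) → List (Fin nV)
  unexpand = map proj₁

  -- lengths, valued in a type A with addition and zero (standing in for ℝ)
  module Lengths {A : Set} (_+ᴬ_ : A → A → A) (0ᴬ : A)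
                 (L : Fin nV → Fin nV → A) where

    routeL : ∀ {ns} → Route ns → A
    routeL (single n) = 0ᴬ
    routeL (step {a} {b} e p) = L a b +ᴬ routeL p

    eRouteL : ∀ {es} → ERoute es → A
    eRouteL (single n r _) = 0ᴬ
    eRouteL (step {nx} {ny = ny} _ _ _ p) = L nx ny +ᴬ eRouteL p

-- Segment uniqueness forces the road of every edge of ρ: the edge (n_m , n_{m+1})
-- lies on r_{m+1}, so R(n_m , n_{m+1}) = r_{m+1}.  Hence C(ρ) is exactly C(ρ_E)
-- without its first term C(n₁ , r₁ , r₂), while both lengths add up the same L(n_m , n_{m+1}).
module Submission where

open import Defs
open import Data.Nat using (ℕ; _≤_; _≥_; _+_; z≤n)
open import Data.Nat.Properties using (m≤n+m)
open import Data.Fin using (Fin)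
open import Data.List using (List; _∷_)
open import Data.Product using (_×_; _,_; proj₁; proj₂)
open import Relation.Binary.PropositionalEquality using (_≡_; refl; cong)

module _ (N : RoadNetwork) where
  open RoadNetwork N

  unexpand-route : ∀ {es} → ERoute N es → Route N (unexpand N es)
  unexpand-route (single n r _)            = single n
  unexpand-route (step {rj = rj} _ _ c ρE) = step (rj , c) (unexpand-route ρE)

  routeCFrom : ∀ {ns} → Fin nR → Route N ns → ℕ
  routeCFrom r (single n) = 0
  routeCFrom r (step e ρ) = turn N r (proj₁ e) + routeCFrom (proj₁ e) ρ

  routeC-step : ∀ {a b ns} (e : Edge N a b) (ρ : Route N (b ∷ ns)) →
                routeC N (step e ρ) ≡ routeCFrom (proj₁ e) ρ
  routeC-step e (single b)  = refl
  routeC-step e (step e′ ρ) = cong (turn N (proj₁ e) (proj₁ e′) +_) (routeC-step e′ ρ)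

  routeCFrom≡eRouteC : ∀ {n r es} (ρE : ERoute N ((n , r) ∷ es))
                       (ρ : Route N (unexpand N ((n , r) ∷ es))) →
                       routeCFrom r ρ ≡ eRouteC N ρE
  routeCFrom≡eRouteC (single n r _) (single .n) = refl
  routeCFrom≡eRouteC (step {nx} {ri} {ny} {rj} _ _ c ρE) (step (r , c′) ρ)
    with segUnique nx ny r rj c′ c
  ... | refl = cong (turn N ri rj +_) (routeCFrom≡eRouteC ρE ρ)

  routeC≤eRouteC : ∀ {es} (ρE : ERoute N es) (ρ : Route N (unexpand N es)) →
                   routeC N ρ ≤ eRouteC N ρE
  routeC≤eRouteC (single n r _) (single .n) = z≤n
  routeC≤eRouteC (step {nx} {ri} {ny} {rj} _ _ c ρE) (step e ρ)
    with segUnique nx ny (proj₁ e) rj (proj₂ e) c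
  ... | refl rewrite routeC-step e ρ | routeCFrom≡eRouteC ρE ρ =
    m≤n+m (eRouteC N ρE) (turn N ri rj)

  module _ {A : Set} (_+ᴬ_ : A → A → A) (0ᴬ : A) (L : Fin nV → Fin nV → A) where
    open Lengths N _+ᴬ_ 0ᴬ L

    eRouteL≡routeL : ∀ {es} (ρE : ERoute N es) (ρ : Route N (unexpand N es)) →
                     eRouteL ρE ≡ routeL ρ
    eRouteL≡routeL (single n r _) (single .n) = refl
    eRouteL≡routeL (step {nx} {ny = ny} _ _ _ ρE) (step _ ρ) =
      cong (L nx ny +ᴬ_) (eRouteL≡routeL ρE ρ)

lemma3 : (N : RoadNetwork) →
    (A : Set) (_+ᴬ_ : A → A → A) (0ᴬ : A) (_<ᴬ_ : A → A → Set) →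
    (L : Fin (RoadNetwork.nV N) → Fin (RoadNetwork.nV N) → A) →
    (∀ a b → Edge N a b → 0ᴬ <ᴬ L a b) →
    (es : List (Fin (RoadNetwork.nV N) × Fin (RoadNetwork.nR N))) →
    (ρE : ERoute N es) →
    Route N (unexpand N es) × ((ρ : Route N (unexpand N es)) →
    (Lengths.eRouteL N _+ᴬ_ 0ᴬ L ρE ≡ Lengths.routeL N _+ᴬ_ 0ᴬ L ρ)
    × (eRouteC N ρE ≥ routeC N ρ))
lemma3 N A _+ᴬ_ 0ᴬ _<ᴬ_ L _ es ρE =
  unexpand-route N ρE ,
  λ ρ → eRouteL≡routeL N _+ᴬ_ 0ᴬ L ρE ρ , routeC≤eRouteC N ρE ρ
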